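{- Let $G=(V,E)$ be a graph with clique number $\omega(G)$. If $G$ admits a $d$-rigid partition, then $d\le(|V|+\omega(G))/2$.
   Context: A $d$-rigid partition of $G$ is a pair $(\{V_i\}_{i=1}^{d+1},\{E_{ij}\}_{1\le i<j\le d+1})$ where $V_1,\dots,V_{d+1}$ are pairwise disjoint with union $V$ (empty sets allowed), the $E_{ij}$ are pairwise disjoint subsets of $E$ with every $e\in E_{ij}$ satisfying $e\subseteq V_i\cup V_j$, each graph $G_{ij}=(V_i\cup V_j,E_{ij})$ is connected (a graph with no vertices counts as disconnected), and for every $i$ and every $U\subseteq V_i$ with $|U|\ge2$ there is a partition $U=U'\cup U''$ into nonempty sets such that all edges of $\bigcup E_{ij}$ between $U'$ and $U''$ lie in a single class $E_{i'j'}$. -}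

module Defs where

open import Data.Nat using (ℕ; suc; _≤_; _≥_)
open import Data.Fin using (Fin; _<_)
open import Data.Fin.Subset using (Subset; _∈_; _∉_; ∣_∣)
open import Data.Product using (Σ; ∃; ∃-syntax; _×_)
open import Data.Sum using (_⊎_)
open import Relation.Nullary using (¬_)
open import Relation.Binary.PropositionalEquality using (_≡_; _≢_)
open import Relation.Binary.Construct.Closure.ReflexiveTransitive using (Star)

record Graph (n : ℕ) : Set₁ where
  field
    Adj   : Fin n → Fin n → Set
    sym   : ∀ {u v} → Adj u v → Adj v u
    irrefl : ∀ {u} → ¬ Adj u u

open Graph public

IsClique : ∀ {n} → Graph n → Subset n → Set
IsClique G S = ∀ u v → u ∈ S → v ∈ S → u ≢ v → Adj G u v

IsCliqueNumber : ∀ {n} → Graph n → ℕ → Set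
IsCliqueNumber {n} G ω =
  (Σ (Subset n) λ S → IsClique G S × ∣ S ∣ ≡ ω) ×
  (∀ (S : Subset n) → IsClique G S → ∣ S ∣ ≤ ω)

-- Parts are indexed by Fin (suc d) (i.e. V_1..V_{d+1});
-- the vertex partition is a map `part` (vertex x lies in V_(part x)); empty parts allowed.
-- Edge classes: `E i j u v` says that the (unordered) edge {u,v} belongs to E_ij (i < j).
record RigidPartition {n : ℕ} (G : Graph n) (d : ℕ) : Set₁ where
  field
    part : Fin n → Fin (suc d)
    E    : Fin (suc d) → Fin (suc d) → Fin n → Fin n → Set
    E-ord  : ∀ {i j u v} → E i j u v → i < j
    E-edge : ∀ {i j u v} → E i j u v → Adj G u v
    E-sym  : ∀ {i j u v} → E i j u v → E i j v u
    E-disj : ∀ {i j i' j' u v} → E i j u v → E i' j' u v → (i ≡ i') × (j ≡ j')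
    E-ends : ∀ {i j u v} → E i j u v →
             (part u ≡ i ⊎ part u ≡ j) × (part v ≡ i ⊎ part v ≡ j)
    -- each G_ij = (V_i ∪ V_j, E_ij) is connected (in particular nonempty)
    conn-nonempty : ∀ (i j : Fin (suc d)) → i < j →
             ∃[ x ] (part x ≡ i ⊎ part x ≡ j)
    conn-path : ∀ (i j : Fin (suc d)) → i < j → ∀ x y →
             (part x ≡ i ⊎ part x ≡ j) → (part y ≡ i ⊎ part y ≡ j) →
             Star (E i j) x y
    -- for every i and U ⊆ V_i with |U| ≥ 2 there is a split U = U' ∪ U''
    -- (U'' = U ∖ U', both nonempty) such that all edges of ⋃ E_ij between U'
    -- and U'' lie in a single class
    split : ∀ (i : Fin (suc d)) (U : Subset n) →
            (∀ x → x ∈ U → part x ≡ i) → ∣ U ∣ ≥ 2 →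
            Σ (Subset n) λ U' →
              (∀ x → x ∈ U' → x ∈ U) ×
              (∃[ x ] x ∈ U') ×
              (∃[ y ] (y ∈ U × y ∉ U')) ×
              (∀ {a b a' b' x y x' y'} →
                 x ∈ U' → y ∈ U → y ∉ U' → E a b x y →
                 x' ∈ U' → y' ∈ U → y' ∉ U' → E a' b' x' y' →
                 (a ≡ a') × (b ≡ b'))

-- Vertices that are alone in their part form a clique: if V_i = {u} and V_j = {v},
-- the first edge of a path from u to v in the connected graph G_ij leaves V_i, so it
-- is uv itself. Moreover at most one part is empty, since every V_i ∪ V_j is nonempty.
-- Give a part of size c the weight 2c if c = 1 and c otherwise: then the total weight
-- is |V| + #singletons ≤ |V| + ω, and all but at most one of the d + 1 parts weigh at
-- least 2.
module Submission where

open import Defs hiding (sym)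
open import Data.Nat using (ℕ; zero; suc; _≤_; _≤?_; _+_; _*_; z≤n; s≤s)
open import Data.Nat.Properties
  using (+-*-semiring; +-mono-≤; +-monoʳ-≤; m≤m+n; m≤n+m; *-suc; *-identityʳ; *-zeroʳ;
         +-identityʳ; ≤-refl; ≤-trans; ≤-reflexive; module ≤-Reasoning)
  renaming (_≟_ to _≟ℕ_)
open import Algebra.Properties.Semiring.Sum +-*-semiring
  using (sum; sum-syntax; sum-cong-≗; sum-remove; sum-replicate-zero; ∑-comm; ∑-distrib-+;
         *-distribˡ-sum)
open import Data.Bool using (if_then_else_)
open import Data.Fin using (Fin; zero; suc; _<_; punchOut)
open import Data.Fin.Properties using (_≟_; <-cmp; <-irrefl; punchIn-punchOut)
open import Data.Fin.Subset using (Subset; _∈_; ∣_∣)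
open import Data.Vec using (tabulate; there)
open import Data.Vec.Functional using (Vector; removeAt)
open import Data.Product using (_,_; proj₂)
open import Data.Sum using (_⊎_; inj₁; inj₂)
open import Data.Empty using (⊥-elim)
open import Function using (_∘_)
open import Relation.Nullary using (Dec; does; yes; no)
open import Relation.Nullary.Decidable using (dec-true)
open import Relation.Unary using (Pred; Decidable)
open import Relation.Binary using (tri<; tri≈; tri>)
open import Relation.Binary.PropositionalEquality
  using (_≡_; _≢_; refl; sym; trans; cong; cong₂; subst; module ≡-Reasoning)
open import Relation.Binary.Construct.Closure.ReflexiveTransitive using (Star; ε; _◅_)

[_] : ∀ {p} {P : Set p} → Dec P → ℕ
[ P? ] = if does P? then 1 else 0

[]-yes : ∀ {p} {P : Set p} (P? : Dec P) → P → [ P? ] ≡ 1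
[]-yes P? p = cong (if_then 1 else 0) (dec-true P? p)

≤-sum : ∀ {m} (f : Vector ℕ m) i → f i ≤ sum f
≤-sum {suc m} f i = ≤-trans (m≤m+n (f i) _) (≤-reflexive (sym (sum-remove {i = i} f)))

+-≤-sum : ∀ {m} (f : Vector ℕ m) {i j} → i ≢ j → f i + f j ≤ sum f
+-≤-sum {suc m} f {i} {j} i≢j = begin
  f i + f j                          ≡⟨ cong (λ k → f i + f k) (sym (punchIn-punchOut i≢j)) ⟩
  f i + removeAt f i (punchOut i≢j)  ≤⟨ +-monoʳ-≤ (f i) (≤-sum (removeAt f i) (punchOut i≢j)) ⟩
  f i + sum (removeAt f i)           ≡⟨ sum-remove f ⟨
  sum f                              ∎
  where open ≤-Reasoning

∑-const-1 : ∀ m → ∑[ i < m ] 1 ≡ m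
∑-const-1 zero    = refl
∑-const-1 (suc m) = cong suc (∑-const-1 m)

∑-δ : ∀ {m} (f : Vector ℕ m) j → ∑[ i < m ] (f i * [ j ≟ i ]) ≡ f j
∑-δ {suc m} f zero = begin
  f zero * 1 + ∑[ i < m ] (f (suc i) * 0)
    ≡⟨ cong₂ _+_ (*-identityʳ (f zero)) (sum-cong-≗ (*-zeroʳ ∘ f ∘ suc)) ⟩
  f zero + ∑[ i < m ] 0                   ≡⟨ cong (f zero +_) (sum-replicate-zero m) ⟩
  f zero + 0                              ≡⟨ +-identityʳ (f zero) ⟩
  f zero                                  ∎
  where open ≡-Reasoning
∑-δ {suc m} f (suc j) =
  trans (cong (_+ ∑[ i < m ] (f (suc i) * [ suc j ≟ suc i ])) (*-zeroʳ (f zero))) (∑-δ (f ∘ suc) j)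

module _ {n m} (p : Fin n → Fin m) where

  fibreSize : Fin m → ℕ
  fibreSize i = ∑[ x < n ] [ p x ≟ i ]

  ∑-∘-fibreSize : (h : Vector ℕ m) → ∑[ x < n ] h (p x) ≡ ∑[ i < m ] (h i * fibreSize i)
  ∑-∘-fibreSize h = begin
    ∑[ x < n ] h (p x)                        ≡⟨ sum-cong-≗ (sym ∘ ∑-δ h ∘ p) ⟩
    ∑[ x < n ] ∑[ i < m ] (h i * [ p x ≟ i ]) ≡⟨ ∑-comm (λ x i → h i * [ p x ≟ i ]) ⟩
    ∑[ i < m ] ∑[ x < n ] (h i * [ p x ≟ i ]) ≡⟨ sum-cong-≗ (λ i → *-distribˡ-sum (h i) (λ x → [ p x ≟ i ])) ⟨
    ∑[ i < m ] (h i * fibreSize i)            ∎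
    where open ≡-Reasoning

  fibreSize-≥1 : ∀ {x i} → p x ≡ i → 1 ≤ fibreSize i
  fibreSize-≥1 {x} {i} px≡i =
    ≤-trans (≤-reflexive (sym ([]-yes (p x ≟ i) px≡i))) (≤-sum (λ z → [ p z ≟ i ]) x)

  fibreSize-≥2 : ∀ {x y i} → x ≢ y → p x ≡ i → p y ≡ i → 2 ≤ fibreSize i
  fibreSize-≥2 {x} {y} {i} x≢y px≡i py≡i =
    ≤-trans (≤-reflexive (sym (cong₂ _+_ ([]-yes (p x ≟ i) px≡i) ([]-yes (p y ≟ i) py≡i))))
            (+-≤-sum (λ z → [ p z ≟ i ]) x≢y)

  fibreSize≡1⇒unique : ∀ {x y i} → fibreSize i ≡ 1 → p x ≡ i → p y ≡ i → x ≡ y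
  fibreSize≡1⇒unique {x} {y} |p⁻¹i|≡1 px≡i py≡i with x ≟ y
  ... | yes x≡y = x≡y
  ... | no x≢y with subst (2 ≤_) |p⁻¹i|≡1 (fibreSize-≥2 x≢y px≡i py≡i)
  ...   | s≤s ()

subsetOf : ∀ {n p} {P : Pred (Fin n) p} → Decidable P → Subset n
subsetOf P? = tabulate (does ∘ P?)

∈-subsetOf⁻ : ∀ {n p} {P : Pred (Fin n) p} (P? : Decidable P) {x} → x ∈ subsetOf P? → P x
∈-subsetOf⁻ P? {zero} x∈ with P? zero | x∈
... | yes Px | _    = Px
... | no _   | ()
∈-subsetOf⁻ P? {suc x} (there x∈) = ∈-subsetOf⁻ (P? ∘ suc) x∈

∣subsetOf∣≡∑ : ∀ {n p} {P : Pred (Fin n) p} (P? : Decidable P) → ∣ subsetOf P? ∣ ≡ ∑[ x < n ] [ P? x ]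
∣subsetOf∣≡∑ {zero}  P? = refl
∣subsetOf∣≡∑ {suc n} P? with P? zero
... | yes _ = cong suc (∣subsetOf∣≡∑ (P? ∘ suc))
... | no _  = ∣subsetOf∣≡∑ (P? ∘ suc)

AtMostOneBelow : ℕ → ∀ {m} → Vector ℕ m → Set
AtMostOneBelow k g = ∀ {i j} → i < j → k ≤ g i ⊎ k ≤ g j

*-≤-sum : ∀ k {m} (g : Vector ℕ m) → (∀ i → k ≤ g i) → k * m ≤ sum g
*-≤-sum k {zero}  g _ = subst (_≤ sum g) (sym (*-zeroʳ k)) z≤n
*-≤-sum k {suc m} g k≤g =
  subst (_≤ sum g) (sym (*-suc k m)) (+-mono-≤ (k≤g zero) (*-≤-sum k (g ∘ suc) (k≤g ∘ suc)))

atMostOneBelow⇒*-≤-sum : ∀ k {m} (g : Vector ℕ (suc m)) → AtMostOneBelow k g → k * m ≤ sum g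
atMostOneBelow⇒*-≤-sum k {zero}  g _ = subst (_≤ sum g) (sym (*-zeroʳ k)) z≤n
atMostOneBelow⇒*-≤-sum k {suc m} g g-ok with k ≤? g zero
... | yes k≤g₀ = subst (_≤ sum g) (sym (*-suc k m))
                   (+-mono-≤ k≤g₀ (atMostOneBelow⇒*-≤-sum k (g ∘ suc) (g-ok ∘ s≤s)))
... | no k≰g₀  = ≤-trans (*-≤-sum k (g ∘ suc) k≤gₛ) (m≤n+m _ (g zero))
  where
  k≤gₛ : ∀ j → k ≤ g (suc j)
  k≤gₛ j with g-ok {zero} {suc j} (s≤s z≤n)
  ... | inj₁ k≤g₀ = ⊥-elim (k≰g₀ k≤g₀)
  ... | inj₂ k≤gⱼ = k≤gⱼ

doubleIfOne : ℕ → ℕ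
doubleIfOne c = (1 + [ c ≟ℕ 1 ]) * c

2≤doubleIfOne : ∀ {c} → 1 ≤ c → 2 ≤ doubleIfOne c
2≤doubleIfOne {1}           _ = ≤-refl
2≤doubleIfOne {suc (suc c)} _ = s≤s (s≤s z≤n)

module _ {n} {G : Graph n} {d} (R : RigidPartition G d) where
  open RigidPartition R

  partSize : Fin (suc d) → ℕ
  partSize = fibreSize part

  singleton-parts-adjacent : ∀ {u v} → partSize (part u) ≡ 1 → partSize (part v) ≡ 1 →
                             part u < part v → Adj G u v
  singleton-parts-adjacent {u} {v} |Vᵤ|≡1 |Vᵥ|≡1 pu<pv =
    first-edge (conn-path (part u) (part v) pu<pv u v (inj₁ refl) (inj₂ refl))
    where
    first-edge : Star (E (part u) (part v)) u v → Adj G u v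
    first-edge ε = ⊥-elim (<-irrefl refl pu<pv)
    first-edge (_◅_ {j = w} uw _) with proj₂ (E-ends uw)
    ... | inj₁ pw≡pu = ⊥-elim (irrefl G (E-edge (subst (E _ _ u) w≡u uw)))
      where w≡u = fibreSize≡1⇒unique part |Vᵤ|≡1 pw≡pu refl
    ... | inj₂ pw≡pv = E-edge (subst (E _ _ u) w≡v uw)
      where w≡v = fibreSize≡1⇒unique part |Vᵥ|≡1 pw≡pv refl

  inSingletonPart? : Decidable (λ x → partSize (part x) ≡ 1)
  inSingletonPart? x = partSize (part x) ≟ℕ 1

  singletons : Subset n
  singletons = subsetOf inSingletonPart?

  ∈-singletons⁻ : ∀ {x} → x ∈ singletons → partSize (part x) ≡ 1
  ∈-singletons⁻ = ∈-subsetOf⁻ inSingletonPart?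

  singletons-isClique : IsClique G singletons
  singletons-isClique u v u∈ v∈ u≢v with <-cmp (part u) (part v)
  ... | tri< pu<pv _ _ = singleton-parts-adjacent (∈-singletons⁻ u∈) (∈-singletons⁻ v∈) pu<pv
  ... | tri> _ _ pv<pu = Graph.sym G (singleton-parts-adjacent (∈-singletons⁻ v∈) (∈-singletons⁻ u∈) pv<pu)
  ... | tri≈ _ pu≡pv _ = ⊥-elim (u≢v (fibreSize≡1⇒unique part (∈-singletons⁻ u∈) refl (sym pu≡pv)))

  weight : Fin (suc d) → ℕ
  weight = doubleIfOne ∘ partSize

  n+∣singletons∣≡∑weight : n + ∣ singletons ∣ ≡ ∑[ i < suc d ] weight i
  n+∣singletons∣≡∑weight = begin
    n + ∣ singletons ∣
      ≡⟨ cong₂ _+_ (sym (∑-const-1 n)) (∣subsetOf∣≡∑ inSingletonPart?) ⟩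
    ∑[ x < n ] 1 + ∑[ x < n ] [ inSingletonPart? x ]
      ≡⟨ ∑-distrib-+ (λ _ → 1) (λ x → [ inSingletonPart? x ]) ⟨
    ∑[ x < n ] (1 + [ partSize (part x) ≟ℕ 1 ])
      ≡⟨ ∑-∘-fibreSize part (λ i → 1 + [ partSize i ≟ℕ 1 ]) ⟩
    ∑[ i < suc d ] weight i
      ∎
    where open ≡-Reasoning

  weight-atMostOneBelow2 : AtMostOneBelow 2 weight
  weight-atMostOneBelow2 {i} {j} i<j with conn-nonempty i j i<j
  ... | _ , inj₁ px≡i = inj₁ (2≤doubleIfOne (fibreSize-≥1 part px≡i))
  ... | _ , inj₂ px≡j = inj₂ (2≤doubleIfOne (fibreSize-≥1 part px≡j))

proposition2p13 : ∀ {n : ℕ} (G : Graph n) (ω d : ℕ) →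
    IsCliqueNumber G ω → RigidPartition G d → 2 * d ≤ n + ω
proposition2p13 {n} G ω d (_ , ω-max) R = begin
  2 * d                         ≤⟨ atMostOneBelow⇒*-≤-sum 2 (weight R) (weight-atMostOneBelow2 R) ⟩
  ∑[ i < suc d ] weight R i     ≡⟨ n+∣singletons∣≡∑weight R ⟨
  n + ∣ singletons R ∣          ≤⟨ +-monoʳ-≤ n (ω-max (singletons R) (singletons-isClique R)) ⟩
  n + ω                         ∎
  where open ≤-Reasoning
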